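{- The subspace of $\textsf{ParSym}$ spanned by $\{\textsf{H}_\pi : \pi \text{ a partial permutation}\}$ is a Hopf subalgebra of $\textsf{ParSym}$: it contains $\textsf{H}_\varnothing$, is closed under the product, $\Delta$ maps it into its tensor square, and the antipode $S$ maps it into itself.
   Context: Partition diagrams of order $k$ are set partitions of $\{1,\ldots,k,1',\ldots,k'\}$; $A_0=\{\varnothing\}$. A partial permutation is a partition diagram each of whose blocks has size one or two, such that every block of size two contains one element of $\{1,\ldots,k\}$ and one element of $\{1',\ldots,k'\}$. For $\pi$ of order $k$, $\rho$ of order $l$: $\pi\otimes\rho$ has as blocks those of $\pi$ and those of $\rho$ shifted ($i\mapsto i+k$, $i'\mapsto(i+k)'$). A diagram is $\otimes$-irreducible if it is not $\rho^{(1)}\otimes\rho^{(2)}$ with both factors nonempty. For nonempty $\pi,\rho$ (orders $k,l$), $\pi\bullet\rho$ is obtained from $\pi\otimes\rho$ by merging the block containing $k'$ with the block containing $(k+1)'$; $\varnothing\bullet\rho=\rho$, $\pi\bullet\varnothing=\pi$. Over a field $\mathbbm{k}$, $\textsf{ParSym}$ has basis $\{\textsf{H}_\pi\}$ over all partition diagrams, product $\textsf{H}_\pi\textsf{H}_\rho=\textsf{H}_{\pi\otimes\rho}$, unit $\textsf{H}_\varnothing$ (free on $\textsf{H}_\pi$, $\pi$ nonempty $\otimes$-irreducible). $\Delta$ is the algebra morphism with $\Delta\textsf{H}_\varnothing=\textsf{H}_\varnothing\otimes\textsf{H}_\varnothing$ and $\Delta\textsf{H}_\pi=\sum\textsf{H}_{G_1}\otimes\textsf{H}_{G_2}$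 for nonempty $\otimes$-irreducible $\pi$, over ordered pairs $(G_1,G_2)$, each $\varnothing$ or $\otimes$-irreducible, with $G_1\bullet G_2=\pi$. $S$ is the linear antimorphism with $S(\textsf{H}_\varnothing)=\textsf{H}_\varnothing$ and $S(\textsf{H}_\pi)=\sum(-1)^\ell\textsf{H}_{\rho^{(1)}}\cdots\textsf{H}_{\rho^{(\ell)}}$ for nonempty $\otimes$-irreducible $\pi$, over tuples of nonempty diagrams with $\rho^{(1)}\bullet\cdots\bullet\rho^{(\ell)}=\pi$. -}

module Defs where

open import Level using (Level; _⊔_) renaming (suc to lsuc)
open import Algebra.Bundles using (CommutativeRing)
open import Data.Nat using (ℕ; zero; suc; _+_; _≡ᵇ_) renaming (_⊔_ to max)
open import Data.Bool using (Bool; true; false; not; _∧_; if_then_else_)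
open import Data.List using (List; []; _∷_; _++_; map; concatMap; foldr; reverse; take; drop; zip; upTo; null; length)
open import Data.Bool.ListAction using (all; any)
open import Data.Product using (Σ; _×_; _,_; proj₁; proj₂)
open import Data.Sum using (_⊎_)
open import Data.List.Relation.Unary.All using (All)
open import Relation.Nullary using (¬_)
open import Relation.Binary.PropositionalEquality using (_≡_)

record Field (c ℓ : Level) : Set (lsuc (c ⊔ ℓ)) where
  field
    commutativeRing : CommutativeRing c ℓ
  open CommutativeRing commutativeRing public
  field
    1≉0 : ¬ (1# ≈ 0#)
    inverse : ∀ x → ¬ (x ≈ 0#) → Σ Carrier λ y → x * y ≈ 1#

-- A diagram of order k is represented by a list of k pairs of labels
-- (a_1 , b_1) ... (a_k , b_k) : the element i gets label a_i and the
-- element i' gets label b_i.  The blocks of the set partition of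
-- {1,..,k,1',..,k'} are the nonempty fibres of the labelling.  Two
-- representations denote the same diagram iff they have the same order
-- and the same kernel (see sameᵇ).

Diagram : Set
Diagram = List (ℕ × ℕ)

order : Diagram → ℕ
order = length

tops bots : Diagram → List ℕ
tops = map proj₁
bots = map proj₂

labels : Diagram → List ℕ
labels d = tops d ++ bots d

-- kernel of a labelling: for all positions p, q, whether p and q are
-- in the same block
kernel : List ℕ → List Bool
kernel xs = concatMap (λ x → map (λ y → x ≡ᵇ y) xs) xs

eqBools : List Bool → List Bool → Bool
eqBools [] [] = true
eqBools (x ∷ xs) (y ∷ ys) = (if x then y else not y) ∧ eqBools xs ys
eqBools _ _ = false

sameᵇ : Diagram → Diagram → Bool
sameᵇ d e = (order d ≡ᵇ order e) ∧ eqBools (kernel (labels d)) (kernel (labels e))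

maxLabel : Diagram → ℕ
maxLabel d = foldr max 0 (labels d)

-- π ⊗ ρ : blocks of π, together with blocks of ρ shifted by the order of π
-- (labels of ρ are shifted so as to be disjoint from those of π)
_⊗_ : Diagram → Diagram → Diagram
π ⊗ ρ = π ++ map (λ { (a , b) → (a + suc (maxLabel π) , b + suc (maxLabel π)) }) ρ

mergeLabels : ℕ → ℕ → Diagram → Diagram
mergeLabels a c = map (λ { (x , y) → (r x , r y) })
  where r : ℕ → ℕ
        r z = if z ≡ᵇ c then a else z

lastBot : (a : ℕ × ℕ) → Diagram → ℕ
lastBot (_ , b) [] = b
lastBot _ (x ∷ xs) = lastBot x xs

-- π • ρ : merge the block of k' with the block of (k+1)' in π ⊗ ρ
_•_ : Diagram → Diagram → Diagram
[] • ρ = ρ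
(x ∷ xs) • [] = x ∷ xs
(x ∷ xs) • ((a , b) ∷ ys) =
  mergeLabels (lastBot x xs) (b + suc (maxLabel (x ∷ xs))) ((x ∷ xs) ⊗ ((a , b) ∷ ys))

-- Partial permutations: every block has size one or two, and a block of
-- size two has one element of {1..k} and one of {1'..k'}.
-- The block with label a has cnt a (tops d) upper and cnt a (bots d)
-- lower elements (size 0 means label a is not used).

cnt : ℕ → List ℕ → ℕ
cnt a [] = 0
cnt a (x ∷ xs) = if a ≡ᵇ x then suc (cnt a xs) else cnt a xs

IsPartialPerm : Diagram → Set
IsPartialPerm d = ∀ a →
  (cnt a (tops d) + cnt a (bots d) ≡ 0) ⊎
  (cnt a (tops d) + cnt a (bots d) ≡ 1) ⊎
  ((cnt a (tops d) ≡ 1) × (cnt a (bots d) ≡ 1))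

-- ⊗-decomposition.  d = ρ¹ ⊗ ρ² with ρ¹ of order j iff no block meets
-- both {1..j,1'..j'} and the remaining elements.

elemᵇ : ℕ → List ℕ → Bool
elemᵇ x = any (λ y → x ≡ᵇ y)

splitsAt : ℕ → Diagram → Bool
splitsAt j d = all (λ x → not (elemᵇ x (labels (drop j d)))) (labels (take j d))

splitPoints : Diagram → List ℕ
splitPoints [] = []
splitPoints (_ ∷ xs) = map suc (upTo (length xs))

properSplitPoints : Diagram → List ℕ
properSplitPoints d = Data.List.filterᵇ (λ j → not (j ≡ᵇ 0) ∧ splitsAt j d) (splitPoints d)

irreducibleᵇ : Diagram → Bool
irreducibleᵇ d = not (null d) ∧ null (properSplitPoints d)

emptyOrIrreducibleᵇ : Diagram → Bool
emptyOrIrreducibleᵇ d = null d Data.Bool.∨ irreducibleᵇ d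

factorsGo : ℕ → Diagram → List Diagram
factorsGo zero d = []
factorsGo (suc n) [] = []
factorsGo (suc n) d with properSplitPoints d
... | [] = d ∷ []
... | j ∷ _ = take j d ∷ factorsGo n (drop j d)

factors : Diagram → List Diagram
factors d = factorsGo (length d) d

-- Enumeration of all partition diagrams of order k, each exactly once
-- (as restricted growth strings of length 2k on 1..k,1'..k').

rgsGo : ℕ → ℕ → List (List ℕ)
rgsGo zero m = [] ∷ []
rgsGo (suc n) m =
  concatMap (λ a → map (a ∷_) (rgsGo n (if a ≡ᵇ m then suc m else m))) (upTo (suc m))

diagramsOfOrder : ℕ → List Diagram
diagramsOfOrder k = map (λ w → zip (take k w) (drop k w)) (rgsGo (k + k) 0)

incHead : List ℕ → List ℕ
incHead [] = []
incHead (x ∷ xs) = suc x ∷ xs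

compositions : ℕ → List (List ℕ)
compositions zero = [] ∷ []
compositions (suc zero) = (1 ∷ []) ∷ []
compositions (suc (suc n)) =
  concatMap (λ c → (1 ∷ c) ∷ incHead c ∷ []) (compositions (suc n))

tuplesOfOrders : List ℕ → List (List Diagram)
tuplesOfOrders [] = [] ∷ []
tuplesOfOrders (k ∷ ks) =
  concatMap (λ d → map (d ∷_) (tuplesOfOrders ks)) (diagramsOfOrder k)

pairsOfTotalOrder : ℕ → List (Diagram × Diagram)
pairsOfTotalOrder k =
  concatMap (λ j → concatMap (λ g₁ → map (g₁ ,_) (diagramsOfOrder (k Data.Nat.∸ j)))
                                (diagramsOfOrder j))
            (upTo (suc k))

-- ParSym over a field: elements are finite formal linear combinations
-- of basis elements H_π, represented as lists of (coefficient , π);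
-- two lists represent the same element iff all coefficients agree.

module ParSym {c ℓ : Level} (F : Field c ℓ) where
  open Field F using (Carrier; 0#; 1#; _≈_; -_) renaming (_+_ to _+ᴷ_; _*_ to _*ᴷ_)

  Elem : Set c
  Elem = List (Carrier × Diagram)

  Elem₂ : Set c
  Elem₂ = List (Carrier × Diagram × Diagram)

  coeff : Elem → Diagram → Carrier
  coeff [] d = 0#
  coeff ((a , π) ∷ x) d = if sameᵇ π d then a +ᴷ coeff x d else coeff x d

  coeff₂ : Elem₂ → Diagram → Diagram → Carrier
  coeff₂ [] d e = 0#
  coeff₂ ((a , π , ρ) ∷ x) d e =
    if sameᵇ π d ∧ sameᵇ ρ e then a +ᴷ coeff₂ x d e else coeff₂ x d e

  H : Diagram → Elem
  H π = (1# , π) ∷ []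

  unitH : Elem
  unitH = H []

  _·_ : Elem → Elem → Elem
  x · y = concatMap (λ { (a , π) → map (λ { (b , ρ) → (a *ᴷ b , π ⊗ ρ) }) y }) x

  _·₂_ : Elem₂ → Elem₂ → Elem₂
  x ·₂ y = concatMap (λ { (a , π₁ , π₂) →
             map (λ { (b , ρ₁ , ρ₂) → (a *ᴷ b , π₁ ⊗ ρ₁ , π₂ ⊗ ρ₂) }) y }) x

  scale : Carrier → Elem → Elem
  scale a = map (λ { (b , π) → (a *ᴷ b , π) })

  scale₂ : Carrier → Elem₂ → Elem₂
  scale₂ a = map (λ { (b , π , ρ) → (a *ᴷ b , π , ρ) })

  sign : ℕ → Carrier
  sign zero = 1#
  sign (suc n) = - sign n

  ΔIrr : Diagram → Elem₂
  ΔIrr π = concatMap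
    (λ { (g₁ , g₂) →
         if emptyOrIrreducibleᵇ g₁ ∧ emptyOrIrreducibleᵇ g₂ ∧ sameᵇ (g₁ • g₂) π
         then (1# , g₁ , g₂) ∷ [] else [] })
    (pairsOfTotalOrder (order π))

  -- Δ on a basis element: algebra morphism, via the factorisation into
  -- ⊗-irreducibles (Δ H_∅ = H_∅ ⊗ H_∅)
  ΔH : Diagram → Elem₂
  ΔH π = foldr (λ σ acc → ΔIrr σ ·₂ acc) ((1# , [] , []) ∷ []) (factors π)

  Δ : Elem → Elem₂
  Δ = concatMap (λ { (a , π) → scale₂ a (ΔH π) })

  bulletAll : List Diagram → Diagram
  bulletAll = foldr _•_ []

  tensorAll : List Diagram → Diagram
  tensorAll = foldr _⊗_ []

  SIrr : Diagram → Elem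
  SIrr π = concatMap
    (λ ρs → if sameᵇ (bulletAll ρs) π then (sign (length ρs) , tensorAll ρs) ∷ [] else [])
    (concatMap tuplesOfOrders (compositions (order π)))

  -- S on a basis element: antimorphism, S(H_{π₁} ⋯ H_{πℓ}) = S(H_{πℓ}) ⋯ S(H_{π₁})
  SH : Diagram → Elem
  SH π = foldr (λ σ acc → acc · SIrr σ) unitH (factors π)

  S : Elem → Elem
  S = concatMap (λ { (a , π) → scale a (SH π) })

  InSpanPP : Elem → Set (c ⊔ ℓ)
  InSpanPP x = Σ Elem λ l → All (λ t → IsPartialPerm (proj₂ t)) l × (∀ d → coeff l d ≈ coeff x d)

  InSpanPP₂ : Elem₂ → Set (c ⊔ ℓ)
  InSpanPP₂ x = Σ Elem₂ λ l →
    All (λ t → IsPartialPerm (proj₁ (proj₂ t)) × IsPartialPerm (proj₂ (proj₂ t))) l ×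
    (∀ d e → coeff₂ l d e ≈ coeff₂ x d e)

-- A diagram is a partial permutation iff its upper labels and its lower labels are each
-- repetition-free.  This is preserved by ⊗ and inherited by ⊗-factors, whereas π • ρ with π, ρ
-- nonempty has k' and (k+1)' in one block and is never a partial permutation.  So if π is a
-- partial permutation, every pair (G₁ , G₂) with G₁ • G₂ = π consists of partial permutations,
-- and so does every tuple with ρ¹ • ⋯ • ρˡ = π, hence also ρ¹ ⊗ ⋯ ⊗ ρˡ.
--
-- Elements of ParSym are lists of terms compared by coefficients, so the substance is
-- well-definedness: Δ, S and the product of basis elements only depend on diagrams up to
-- relabelling (≅), and a sum Σ aᵢ g(πᵢ) with g constant on relabelling classes only depends on
-- the coefficients of Σ aᵢ H_πᵢ, as one sees by removing one class at a time.

module Submission where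

open import Level using (Level)
open import Defs
open import Data.Nat using (ℕ; zero; suc; _+_; _∸_; _⊓_; _≡ᵇ_; _≤_; z≤n; s≤s) renaming (_⊔_ to max)
open import Data.Nat.Properties
  using (≡ᵇ⇒≡; ≡⇒≡ᵇ; ≤-refl; ≤-trans; ≤-reflexive; ≤-pred; m≤m⊔n; m≤n⊔m; m≤m+n; m≤n+m; n≤1+n;
         +-cancelʳ-≡; <-irrefl; suc-injective; +-mono-≤)
open import Data.Bool using (Bool; true; false; not; _∧_; if_then_else_)
open import Data.Bool.Properties using (T-≡)
open import Data.Bool.ListAction using (and; or)
open import Data.List using (List; []; _∷_; _++_; map; concat; concatMap; foldr; take; drop; zip; length; filterᵇ; upTo)
open import Data.List.Properties
  using (map-++; map-∘; concatMap-cong; zipWith-zeroʳ; length-map; length-++; length-take; length-drop; zip-map; take-map; drop-map;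
         ++-assoc; ∷-injectiveˡ; ∷-injectiveʳ)
open import Data.List.Membership.Propositional using (_∈_)
open import Data.List.Membership.Propositional.Properties using (∈-++⁺ˡ; ∈-++⁺ʳ; ∈-++⁻; ∈-map⁺; ∈-map⁻)
open import Data.List.Relation.Binary.Subset.Propositional using (_⊆_)
open import Data.List.Relation.Binary.Pointwise using (Pointwise; []; _∷_)
open import Data.List.Relation.Unary.Any using (here; there)
open import Data.List.Relation.Unary.All as All using (All; []; _∷_)
open import Data.List.Relation.Unary.All.Properties using (concat⁺; map⁺)
open import Data.List.Relation.Unary.AllPairs using ([]; _∷_)
open import Data.List.Relation.Unary.Unique.Propositional using (Unique)
import Data.List.Relation.Unary.Unique.Propositional.Properties as Unique
open import Data.Product as Product using (∃-syntax; _×_; _,_; proj₁; proj₂)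
open import Data.Sum using (_⊎_; inj₁; inj₂)
open import Data.Empty using (⊥-elim)
open import Function using (_∘_)
open import Function.Bundles using (Equivalence)
open import Relation.Binary.PropositionalEquality
  using (_≡_; _≢_; refl; sym; trans; cong; cong₂; subst; ≢-sym; module ≡-Reasoning)
open import Relation.Nullary using (¬_)

≡ᵇ-true⇒≡ : ∀ {m n} → (m ≡ᵇ n) ≡ true → m ≡ n
≡ᵇ-true⇒≡ {m} {n} e = ≡ᵇ⇒≡ m n (Equivalence.from T-≡ e)

≡⇒≡ᵇ-true : ∀ {m n} → m ≡ n → (m ≡ᵇ n) ≡ true
≡⇒≡ᵇ-true {m} {n} e = Equivalence.to T-≡ (≡⇒≡ᵇ m n e)

≢⇒≡ᵇ-false : ∀ {m n} → m ≢ n → (m ≡ᵇ n) ≡ false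
≢⇒≡ᵇ-false {m} {n} m≢n with m ≡ᵇ n in e
... | true = ⊥-elim (m≢n (≡ᵇ-true⇒≡ e))
... | false = refl

≡ᵇ-cong : ∀ {m n m′ n′} → (m ≡ n → m′ ≡ n′) → (m′ ≡ n′ → m ≡ n) → (m ≡ᵇ n) ≡ (m′ ≡ᵇ n′)
≡ᵇ-cong {m} {n} {m′} {n′} to from with m ≡ᵇ n in e | m′ ≡ᵇ n′ in e′
... | true  | true  = refl
... | false | false = refl
... | true  | false = trans (sym (≡⇒≡ᵇ-true (to (≡ᵇ-true⇒≡ e)))) e′
... | false | true  = trans (sym e) (≡⇒≡ᵇ-true (from (≡ᵇ-true⇒≡ e′)))

≡ᵇ-+ʳ : ∀ s x y → (x + s ≡ᵇ y + s) ≡ (x ≡ᵇ y)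
≡ᵇ-+ʳ s x y = ≡ᵇ-cong (+-cancelʳ-≡ s x y) (cong (_+ s))

∧-true⇒ : ∀ {a b} → (a ∧ b) ≡ true → a ≡ true × b ≡ true
∧-true⇒ {true} {true} _ = refl , refl

length-map-≡ : ∀ {A B C : Set} {f : A → C} {g : B → C} xs ys →
               length xs ≡ length ys → length (map f xs) ≡ length (map g ys)
length-map-≡ {f = f} {g} xs ys l = trans (length-map f xs) (trans l (sym (length-map g ys)))

++-injective : ∀ {A : Set} (u u′ : List A) {v v′} → length u ≡ length u′ → u ++ v ≡ u′ ++ v′ → u ≡ u′ × v ≡ v′
++-injective [] [] _ e = refl , e
++-injective (x ∷ u) (x′ ∷ u′) l e =
  let u≡u′ , v≡v′ = ++-injective u u′ (suc-injective l) (∷-injectiveʳ e)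
  in cong₂ _∷_ (∷-injectiveˡ e) u≡u′ , v≡v′

zip-++ : ∀ {A B : Set} (xs : List A) (ys : List B) {xs′ ys′} →
         length xs ≡ length ys → zip (xs ++ xs′) (ys ++ ys′) ≡ zip xs ys ++ zip xs′ ys′
zip-++ [] [] _ = refl
zip-++ (x ∷ xs) (y ∷ ys) l = cong ((x , y) ∷_) (zip-++ xs ys (suc-injective l))

∈-zip⁻ : ∀ {A B : Set} {xs : List A} {ys : List B} {x y} → (x , y) ∈ zip xs ys → x ∈ xs × y ∈ ys
∈-zip⁻ {xs = _ ∷ _} {_ ∷ _} (here refl) = here refl , here refl
∈-zip⁻ {xs = _ ∷ _} {_ ∷ _} (there m) = Product.map there there (∈-zip⁻ m)

∈-zip-partner : ∀ {A B : Set} (xs : List A) {ys : List B} {y} →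
                length xs ≡ length ys → y ∈ ys → ∃[ x ] (x , y) ∈ zip xs ys
∈-zip-partner (x ∷ xs) {_ ∷ ys} l (here refl) = x , here refl
∈-zip-partner (x ∷ xs) {_ ∷ ys} l (there m) =
  Product.map₂ there (∈-zip-partner xs (suc-injective l) m)

zip-take⊆ : ∀ {A B : Set} j (xs : List A) (ys : List B) → zip (take j xs) (take j ys) ⊆ zip xs ys
zip-take⊆ (suc j) (x ∷ xs) (y ∷ ys) (here refl) = here refl
zip-take⊆ (suc j) (x ∷ xs) (y ∷ ys) (there m) = there (zip-take⊆ j xs ys m)

zip-drop⊆ : ∀ {A B : Set} j (xs : List A) (ys : List B) → zip (drop j xs) (drop j ys) ⊆ zip xs ys
zip-drop⊆ zero xs ys m = m
zip-drop⊆ (suc j) (x ∷ xs) (y ∷ ys) m = there (zip-drop⊆ j xs ys m)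
zip-drop⊆ (suc j) [] (_ ∷ _) ()
zip-drop⊆ (suc j) (_ ∷ xs) [] m with () ← subst (_ ∈_) (zipWith-zeroʳ _,_ (drop j xs)) m

filterᵇ-cong : ∀ {A : Set} {p q : A → Bool} → (∀ x → p x ≡ q x) → ∀ xs → filterᵇ p xs ≡ filterᵇ q xs
filterᵇ-cong p≗q [] = refl
filterᵇ-cong {p = p} {q} p≗q (x ∷ xs) rewrite p≗q x with q x
... | true = cong (x ∷_) (filterᵇ-cong p≗q xs)
... | false = filterᵇ-cong p≗q xs

Unique-++-∷-∷ : ∀ {A : Set} (w : List A) {y z zs} → Unique (w ++ y ∷ z ∷ zs) → y ≢ z
Unique-++-∷-∷ [] ((y≢z ∷ _) ∷ _) = y≢z
Unique-++-∷-∷ (_ ∷ w) (_ ∷ u) = Unique-++-∷-∷ w u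

Agree : ℕ × ℕ → ℕ × ℕ → Set
Agree p q = (proj₁ p ≡ᵇ proj₁ q) ≡ (proj₂ p ≡ᵇ proj₂ q)

Agree-≢ : ∀ {p q} → proj₁ p ≢ proj₁ q → proj₂ p ≢ proj₂ q → Agree p q
Agree-≢ ≢₁ ≢₂ = trans (≢⇒≡ᵇ-false ≢₁) (sym (≢⇒≡ᵇ-false ≢₂))

Coherent : List (ℕ × ℕ) → List (ℕ × ℕ) → Set
Coherent ps qs = ∀ {p q} → p ∈ ps → q ∈ qs → Agree p q

Coherent-mono : ∀ {ps ps′ qs qs′} → ps ⊆ ps′ → qs ⊆ qs′ → Coherent ps′ qs′ → Coherent ps qs
Coherent-mono ps⊆ qs⊆ coh p∈ q∈ = coh (ps⊆ p∈) (qs⊆ q∈)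

-- kernel xs is definitionally concat (rows xs xs).
rows : List ℕ → List ℕ → List (List Bool)
rows as bs = map (λ a → map (a ≡ᵇ_) bs) as

module _ (a a′ : ℕ) where

  row≡⇒Agree : ∀ bs bs′ → map (a ≡ᵇ_) bs ≡ map (a′ ≡ᵇ_) bs′ → All (Agree (a , a′)) (zip bs bs′)
  row≡⇒Agree [] _ _ = []
  row≡⇒Agree (_ ∷ _) [] _ = []
  row≡⇒Agree (b ∷ bs) (b′ ∷ bs′) e = ∷-injectiveˡ e ∷ row≡⇒Agree bs bs′ (∷-injectiveʳ e)

  Agree⇒row≡ : ∀ bs bs′ → length bs ≡ length bs′ → All (Agree (a , a′)) (zip bs bs′) →
               map (a ≡ᵇ_) bs ≡ map (a′ ≡ᵇ_) bs′
  Agree⇒row≡ [] [] _ _ = refl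
  Agree⇒row≡ (b ∷ bs) (b′ ∷ bs′) l (agree ∷ agrees) =
    cong₂ _∷_ agree (Agree⇒row≡ bs bs′ (suc-injective l) agrees)

Coherent⇒rows≡ : ∀ as as′ {bs bs′} → length as ≡ length as′ → length bs ≡ length bs′ →
                 Coherent (zip as as′) (zip bs bs′) → rows as bs ≡ rows as′ bs′
Coherent⇒rows≡ [] [] _ _ _ = refl
Coherent⇒rows≡ (a ∷ as) (a′ ∷ as′) {bs} {bs′} la lb coh =
  cong₂ _∷_ (Agree⇒row≡ a a′ bs bs′ lb (All.tabulate (coh (here refl))))
            (Coherent⇒rows≡ as as′ (suc-injective la) lb (coh ∘ there))

concat-rows≡⇒Coherent : ∀ as as′ {bs bs′} → length bs ≡ length bs′ →
                        concat (rows as bs) ≡ concat (rows as′ bs′) → Coherent (zip as as′) (zip bs bs′)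
concat-rows≡⇒Coherent (a ∷ as) (a′ ∷ as′) {bs} {bs′} lb e p∈ q∈
  with ++-injective (map (a ≡ᵇ_) bs) (map (a′ ≡ᵇ_) bs′) (length-map-≡ bs bs′ lb) e | p∈
... | row≡ , _ | here refl = All.lookup (row≡⇒Agree a a′ bs bs′ row≡) q∈
... | _ , rest≡ | there p∈′ = concat-rows≡⇒Coherent as as′ lb rest≡ p∈′ q∈

-- Representations of the same diagram

infix 4 _≅_
record _≅_ (d e : Diagram) : Set where
  constructor mk≅
  field
    order≡ : order d ≡ order e
    kernel≡ : kernel (labels d) ≡ kernel (labels e)
open _≅_

eqBools-true⇒≡ : ∀ u v → eqBools u v ≡ true → u ≡ v
eqBools-true⇒≡ [] [] _ = refl
eqBools-true⇒≡ (true ∷ u) (true ∷ v) e = cong (true ∷_) (eqBools-true⇒≡ u v e)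
eqBools-true⇒≡ (false ∷ u) (false ∷ v) e = cong (false ∷_) (eqBools-true⇒≡ u v e)

eqBools-refl : ∀ u → eqBools u u ≡ true
eqBools-refl [] = refl
eqBools-refl (true ∷ u) = eqBools-refl u
eqBools-refl (false ∷ u) = eqBools-refl u

sameᵇ⇒≅ : ∀ d e → sameᵇ d e ≡ true → d ≅ e
sameᵇ⇒≅ d e h = let o , k = ∧-true⇒ h in mk≅ (≡ᵇ-true⇒≡ o) (eqBools-true⇒≡ _ _ k)

sameᵇ-refl : ∀ d → sameᵇ d d ≡ true
sameᵇ-refl d = cong₂ _∧_ (≡⇒≡ᵇ-true {order d} refl) (eqBools-refl (kernel (labels d)))

sameᵇ-respʳ : ∀ f {d e} → d ≅ e → sameᵇ f d ≡ sameᵇ f e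
sameᵇ-respʳ f (mk≅ o k) = cong₂ (λ n κ → (order f ≡ᵇ n) ∧ eqBools (kernel (labels f)) κ) o k

sameᵇ-respˡ : ∀ f {d e} → d ≅ e → sameᵇ d f ≡ sameᵇ e f
sameᵇ-respˡ f (mk≅ o k) = cong₂ (λ n κ → (n ≡ᵇ order f) ∧ eqBools κ (kernel (labels f))) o k

≅-refl : ∀ {d} → d ≅ d
≅-refl = mk≅ refl refl

≅-sym : ∀ {d e} → d ≅ e → e ≅ d
≅-sym (mk≅ o k) = mk≅ (sym o) (sym k)

topPair bottomPair : (ℕ × ℕ) × (ℕ × ℕ) → ℕ × ℕ
topPair q = proj₁ (proj₁ q) , proj₁ (proj₂ q)
bottomPair q = proj₂ (proj₁ q) , proj₂ (proj₂ q)

labelPairs : Diagram → Diagram → List (ℕ × ℕ)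
labelPairs d e = map topPair (zip d e) ++ map bottomPair (zip d e)

length-labels : ∀ d e → order d ≡ order e → length (labels d) ≡ length (labels e)
length-labels d e o = begin
  length (tops d ++ bots d)         ≡⟨ length-++ (tops d) ⟩
  length (tops d) + length (bots d) ≡⟨ cong₂ _+_ (length-map-≡ d e o) (length-map-≡ d e o) ⟩
  length (tops e) + length (bots e) ≡⟨ length-++ (tops e) ⟨
  length (tops e ++ bots e)         ∎
  where open ≡-Reasoning

zip-labels : ∀ d e → order d ≡ order e → zip (labels d) (labels e) ≡ labelPairs d e
zip-labels d e o = begin
  zip (tops d ++ bots d) (tops e ++ bots e)      ≡⟨ zip-++ (tops d) (tops e) (length-map-≡ d e o) ⟩
  zip (tops d) (tops e) ++ zip (bots d) (bots e)
    ≡⟨ cong₂ _++_ (zip-map proj₁ proj₁ d e) (zip-map proj₂ proj₂ d e) ⟩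
  labelPairs d e                                 ∎
  where open ≡-Reasoning

∈-labelPairs⁻ : ∀ {d e p} → p ∈ labelPairs d e → ∃[ q ] q ∈ zip d e × (p ≡ topPair q ⊎ p ≡ bottomPair q)
∈-labelPairs⁻ {d} {e} p∈ with ∈-++⁻ (map topPair (zip d e)) p∈
... | inj₁ p∈ᵗ = let q , q∈ , p≡ = ∈-map⁻ topPair p∈ᵗ in q , q∈ , inj₁ p≡
... | inj₂ p∈ᵇ = let q , q∈ , p≡ = ∈-map⁻ bottomPair p∈ᵇ in q , q∈ , inj₂ p≡

∈-labelPairs⁺ : ∀ {d e p q} → q ∈ zip d e → p ≡ topPair q ⊎ p ≡ bottomPair q → p ∈ labelPairs d e
∈-labelPairs⁺ q∈ (inj₁ refl) = ∈-++⁺ˡ (∈-map⁺ topPair q∈)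
∈-labelPairs⁺ {d} {e} q∈ (inj₂ refl) = ∈-++⁺ʳ (map topPair (zip d e)) (∈-map⁺ bottomPair q∈)

labelPairs-mono : ∀ {d e d′ e′} → zip d e ⊆ zip d′ e′ → labelPairs d e ⊆ labelPairs d′ e′
labelPairs-mono zip⊆ p∈ = let _ , q∈ , p≡ = ∈-labelPairs⁻ p∈ in ∈-labelPairs⁺ (zip⊆ q∈) p≡

∈-labelPairs⇒∈-labels : ∀ {d e p} → p ∈ labelPairs d e → proj₁ p ∈ labels d × proj₂ p ∈ labels e
∈-labelPairs⇒∈-labels {d} {e} p∈ with ∈-labelPairs⁻ p∈
... | (u , v) , q∈ , inj₁ refl =
  let u∈ , v∈ = ∈-zip⁻ q∈ in ∈-++⁺ˡ (∈-map⁺ proj₁ u∈) , ∈-++⁺ˡ (∈-map⁺ proj₁ v∈)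
... | (u , v) , q∈ , inj₂ refl =
  let u∈ , v∈ = ∈-zip⁻ q∈
  in ∈-++⁺ʳ (tops d) (∈-map⁺ proj₂ u∈) , ∈-++⁺ʳ (tops e) (∈-map⁺ proj₂ v∈)

≅⇒Coherent : ∀ {d e} → d ≅ e → Coherent (labelPairs d e) (labelPairs d e)
≅⇒Coherent {d} {e} (mk≅ o k) = subst (λ ps → Coherent ps ps) (zip-labels d e o)
  (concat-rows≡⇒Coherent (labels d) (labels e) (length-labels d e o) k)

Coherent⇒≅ : ∀ {d e} → order d ≡ order e → Coherent (labelPairs d e) (labelPairs d e) → d ≅ e
Coherent⇒≅ {d} {e} o coh = mk≅ o (cong concat
  (Coherent⇒rows≡ (labels d) (labels e) (length-labels d e o) (length-labels d e o)
    (subst (λ ps → Coherent ps ps) (sym (zip-labels d e o)) coh)))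

-- Partial permutations

UniqueLabels : Diagram → Set
UniqueLabels d = Unique (tops d) × Unique (bots d)

cnt≡0 : ∀ {a} xs → All (a ≢_) xs → cnt a xs ≡ 0
cnt≡0 [] [] = refl
cnt≡0 (x ∷ xs) (a≢x ∷ a∉xs) rewrite ≢⇒≡ᵇ-false a≢x = cnt≡0 xs a∉xs

cnt-∷-self : ∀ a xs → cnt a (a ∷ xs) ≡ suc (cnt a xs)
cnt-∷-self a xs rewrite ≡⇒≡ᵇ-true {a} refl = refl

cnt≤cnt-∷ : ∀ a x xs → cnt a xs ≤ cnt a (x ∷ xs)
cnt≤cnt-∷ a x xs with a ≡ᵇ x
... | true = n≤1+n _
... | false = ≤-refl

∈⇒1≤cnt : ∀ {a xs} → a ∈ xs → 1 ≤ cnt a xs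
∈⇒1≤cnt {a} {_ ∷ xs} (here refl) = subst (1 ≤_) (sym (cnt-∷-self a xs)) (s≤s z≤n)
∈⇒1≤cnt {a} {x ∷ xs} (there a∈) = ≤-trans (∈⇒1≤cnt a∈) (cnt≤cnt-∷ a x xs)

Unique⇒cnt≤1 : ∀ {xs} → Unique xs → ∀ a → cnt a xs ≤ 1
Unique⇒cnt≤1 [] a = z≤n
Unique⇒cnt≤1 {x ∷ xs} (x∉xs ∷ u) a with a ≡ᵇ x in e
... | true = subst (λ y → suc (cnt y xs) ≤ 1) (sym (≡ᵇ-true⇒≡ e)) (s≤s (≤-reflexive (cnt≡0 xs x∉xs)))
... | false = Unique⇒cnt≤1 u a

cnt≤1⇒Unique : ∀ xs → (∀ a → cnt a xs ≤ 1) → Unique xs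
cnt≤1⇒Unique [] _ = []
cnt≤1⇒Unique (x ∷ xs) cnt≤1 =
  All.tabulate x∉xs ∷ cnt≤1⇒Unique xs (λ a → ≤-trans (cnt≤cnt-∷ a x xs) (cnt≤1 a))
  where
    x∉xs : ∀ {y} → y ∈ xs → x ≢ y
    x∉xs y∈ refl with ≤-trans (∈⇒1≤cnt y∈) (≤-pred (subst (_≤ 1) (cnt-∷-self x xs) (cnt≤1 x)))
    ... | ()

summands≤ : ∀ {t b n} → t + b ≤ n → t ≤ n × b ≤ n
summands≤ {t} {b} le = ≤-trans (m≤m+n t b) le , ≤-trans (m≤n+m b t) le

blockShape⇒≤1 : ∀ {t b} → (t + b ≡ 0) ⊎ (t + b ≡ 1) ⊎ (t ≡ 1 × b ≡ 1) → t ≤ 1 × b ≤ 1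
blockShape⇒≤1 (inj₁ e) = summands≤ (≤-trans (≤-reflexive e) z≤n)
blockShape⇒≤1 (inj₂ (inj₁ e)) = summands≤ (≤-reflexive e)
blockShape⇒≤1 (inj₂ (inj₂ (refl , refl))) = ≤-refl , ≤-refl

≤1⇒blockShape : ∀ {t b} → t ≤ 1 → b ≤ 1 → (t + b ≡ 0) ⊎ (t + b ≡ 1) ⊎ (t ≡ 1 × b ≡ 1)
≤1⇒blockShape {0} {0} _ _ = inj₁ refl
≤1⇒blockShape {0} {1} _ _ = inj₂ (inj₁ refl)
≤1⇒blockShape {1} {0} _ _ = inj₂ (inj₁ refl)
≤1⇒blockShape {1} {1} _ _ = inj₂ (inj₂ (refl , refl))
≤1⇒blockShape {suc (suc _)} (s≤s ()) _
≤1⇒blockShape {_} {suc (suc _)} _ (s≤s ())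

partialPerm⇒uniqueLabels : ∀ d → IsPartialPerm d → UniqueLabels d
partialPerm⇒uniqueLabels d pp =
  cnt≤1⇒Unique (tops d) (proj₁ ∘ blockShape⇒≤1 ∘ pp) ,
  cnt≤1⇒Unique (bots d) (proj₂ ∘ blockShape⇒≤1 ∘ pp)

uniqueLabels⇒partialPerm : ∀ d → UniqueLabels d → IsPartialPerm d
uniqueLabels⇒partialPerm d (uᵗ , uᵇ) a = ≤1⇒blockShape (Unique⇒cnt≤1 uᵗ a) (Unique⇒cnt≤1 uᵇ a)

Unique-resp-Coherent : ∀ xs ys → length xs ≡ length ys → Coherent (zip xs ys) (zip xs ys) → Unique xs → Unique ys
Unique-resp-Coherent [] [] _ _ _ = []
Unique-resp-Coherent (x ∷ xs) (y ∷ ys) l coh (x∉xs ∷ u) =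
  All.tabulate y∉ys ∷ Unique-resp-Coherent xs ys (suc-injective l) (λ p∈ q∈ → coh (there p∈) (there q∈)) u
  where
    y∉ys : ∀ {y′} → y′ ∈ ys → y ≢ y′
    y∉ys y′∈ refl =
      let x′ , xy′∈ = ∈-zip-partner xs (suc-injective l) y′∈
      in All.lookup x∉xs (proj₁ (∈-zip⁻ xy′∈))
           (≡ᵇ-true⇒≡ (trans (coh (here refl) (there xy′∈)) (≡⇒≡ᵇ-true {y} refl)))

zip-tops⊆labelPairs : ∀ d e → zip (tops d) (tops e) ⊆ labelPairs d e
zip-tops⊆labelPairs d e p∈ = ∈-++⁺ˡ (subst (_ ∈_) (zip-map proj₁ proj₁ d e) p∈)

zip-bots⊆labelPairs : ∀ d e → zip (bots d) (bots e) ⊆ labelPairs d e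
zip-bots⊆labelPairs d e p∈ = ∈-++⁺ʳ (map topPair (zip d e)) (subst (_ ∈_) (zip-map proj₂ proj₂ d e) p∈)

uniqueLabels-resp-≅ : ∀ {d e} → d ≅ e → UniqueLabels d → UniqueLabels e
uniqueLabels-resp-≅ {d} {e} d≅e (uᵗ , uᵇ) =
  Unique-resp-Coherent (tops d) (tops e) (length-map-≡ d e o) (Coherent-mono tops⊆ tops⊆ coh) uᵗ ,
  Unique-resp-Coherent (bots d) (bots e) (length-map-≡ d e o) (Coherent-mono bots⊆ bots⊆ coh) uᵇ
  where
    o = order≡ d≅e
    coh = ≅⇒Coherent d≅e
    tops⊆ = zip-tops⊆labelPairs d e
    bots⊆ = zip-bots⊆labelPairs d e

-- Products of diagrams

offset : Diagram → ℕ
offset π = suc (maxLabel π)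

shift : ℕ → ℕ × ℕ → ℕ × ℕ
shift s p = proj₁ p + s , proj₂ p + s

order-⊗ : ∀ π ρ → order (π ⊗ ρ) ≡ order π + order ρ
order-⊗ π ρ = trans (length-++ π) (cong (order π +_) (length-map _ ρ))

tops-⊗ : ∀ π ρ → tops (π ⊗ ρ) ≡ tops π ++ map (_+ offset π) (tops ρ)
tops-⊗ π ρ = trans (map-++ proj₁ π _) (cong (tops π ++_)
  (trans (sym (map-∘ {g = proj₁} {f = shift (offset π)} ρ)) (map-∘ {g = _+ offset π} {f = proj₁} ρ)))

bots-⊗ : ∀ π ρ → bots (π ⊗ ρ) ≡ bots π ++ map (_+ offset π) (bots ρ)
bots-⊗ π ρ = trans (map-++ proj₂ π _) (cong (bots π ++_)
  (trans (sym (map-∘ {g = proj₂} {f = shift (offset π)} ρ)) (map-∘ {g = _+ offset π} {f = proj₂} ρ)))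

∈-labels⇒≤maxLabel : ∀ {x} π → x ∈ labels π → x ≤ maxLabel π
∈-labels⇒≤maxLabel π = ≤foldr-max (labels π)
  where
    ≤foldr-max : ∀ {x} xs → x ∈ xs → x ≤ foldr max 0 xs
    ≤foldr-max (y ∷ xs) (here refl) = m≤m⊔n y _
    ≤foldr-max (y ∷ xs) (there x∈) = ≤-trans (≤foldr-max xs x∈) (m≤n⊔m y _)

∈-labels⇒≢shifted : ∀ {x} π y → x ∈ labels π → x ≢ y + offset π
∈-labels⇒≢shifted π y x∈ refl = <-irrefl refl (≤-trans (m≤n+m (offset π) y) (∈-labels⇒≤maxLabel π x∈))

Unique-++-shifted : ∀ π {xs ys} → xs ⊆ labels π → Unique xs → Unique ys → Unique (xs ++ map (_+ offset π) ys)
Unique-++-shifted π xs⊆ uxs uys = Unique.++⁺ uxs (Unique.map⁺ (+-cancelʳ-≡ _ _ _) uys) disjoint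
  where
    disjoint : ∀ {v} → ¬ (v ∈ _ × v ∈ map (_+ offset π) _)
    disjoint (v∈xs , v∈shifted) =
      let y , _ , v≡ = ∈-map⁻ (_+ offset π) v∈shifted in ∈-labels⇒≢shifted π y (xs⊆ v∈xs) v≡

[]-uniqueLabels : UniqueLabels []
[]-uniqueLabels = [] , []

⊗-uniqueLabels : ∀ {π ρ} → UniqueLabels π → UniqueLabels ρ → UniqueLabels (π ⊗ ρ)
⊗-uniqueLabels {π} {ρ} (uᵗ , uᵇ) (vᵗ , vᵇ) =
  subst Unique (sym (tops-⊗ π ρ)) (Unique-++-shifted π ∈-++⁺ˡ uᵗ vᵗ) ,
  subst Unique (sym (bots-⊗ π ρ)) (Unique-++-shifted π (∈-++⁺ʳ (tops π)) uᵇ vᵇ)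

take-uniqueLabels : ∀ j {d} → UniqueLabels d → UniqueLabels (take j d)
take-uniqueLabels j {d} (uᵗ , uᵇ) =
  subst Unique (take-map j d) (Unique.take⁺ j uᵗ) , subst Unique (take-map j d) (Unique.take⁺ j uᵇ)

drop-uniqueLabels : ∀ j {d} → UniqueLabels d → UniqueLabels (drop j d)
drop-uniqueLabels j {d} (uᵗ , uᵇ) =
  subst Unique (drop-map j d) (Unique.drop⁺ j uᵗ) , subst Unique (drop-map j d) (Unique.drop⁺ j uᵇ)

factorsGo-uniqueLabels : ∀ n {d} → UniqueLabels d → All UniqueLabels (factorsGo n d)
factorsGo-uniqueLabels zero _ = []
factorsGo-uniqueLabels (suc n) {[]} _ = []
factorsGo-uniqueLabels (suc n) {x ∷ d} u with properSplitPoints (x ∷ d)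
... | [] = u ∷ []
... | j ∷ _ = take-uniqueLabels j u ∷ factorsGo-uniqueLabels n (drop-uniqueLabels j u)

factors-uniqueLabels : ∀ {d} → UniqueLabels d → All UniqueLabels (factors d)
factors-uniqueLabels {d} = factorsGo-uniqueLabels (length d)

relabel : ℕ → ℕ → ℕ → ℕ
relabel a c z = if z ≡ᵇ c then a else z

bots-mergeLabels : ∀ a c D → bots (mergeLabels a c D) ≡ map (relabel a c) (bots D)
bots-mergeLabels a c [] = refl
bots-mergeLabels a c (_ ∷ D) = cong (_ ∷_) (bots-mergeLabels a c D)

bots-lastBot : ∀ x xs → ∃[ w ] bots (x ∷ xs) ≡ w ++ lastBot x xs ∷ []
bots-lastBot x [] = [] , refl
bots-lastBot x (y ∷ xs) = let w , e = bots-lastBot y xs in proj₂ x ∷ w , cong (proj₂ x ∷_) e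

-- The merged block contains both lower points k' and (k+1)'.
•-not-uniqueLabels : ∀ x xs a b ys → ¬ UniqueLabels ((x ∷ xs) • ((a , b) ∷ ys))
•-not-uniqueLabels x xs a b ys (_ , u) =
  Unique-++-∷-∷ (map r w) (subst Unique bots≡ u) (trans rL≡L (sym rc≡L))
  where
    g = x ∷ xs
    L = lastBot x xs
    c = b + offset g
    r = relabel L c
    w = proj₁ (bots-lastBot x xs)
    rest = map (_+ offset g) (bots ys)

    bots≡ : bots (g • ((a , b) ∷ ys)) ≡ map r w ++ r L ∷ r c ∷ map r rest
    bots≡ = begin
      bots (mergeLabels L c (g ⊗ ((a , b) ∷ ys)))
        ≡⟨ bots-mergeLabels L c (g ⊗ ((a , b) ∷ ys)) ⟩
      map r (bots (g ⊗ ((a , b) ∷ ys)))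
        ≡⟨ cong (map r) (bots-⊗ g _) ⟩
      map r (bots g ++ c ∷ rest)
        ≡⟨ cong (λ v → map r (v ++ c ∷ rest)) (proj₂ (bots-lastBot x xs)) ⟩
      map r ((w ++ L ∷ []) ++ c ∷ rest)
        ≡⟨ cong (map r) (++-assoc w _ _) ⟩
      map r (w ++ L ∷ c ∷ rest)
        ≡⟨ map-++ r w _ ⟩
      map r w ++ r L ∷ r c ∷ map r rest ∎
      where open ≡-Reasoning

    L∈labels : L ∈ labels g
    L∈labels = ∈-++⁺ʳ (tops g) (subst (L ∈_) (sym (proj₂ (bots-lastBot x xs))) (∈-++⁺ʳ w (here refl)))

    rL≡L : r L ≡ L
    rL≡L rewrite ≢⇒≡ᵇ-false (∈-labels⇒≢shifted g b L∈labels) = refl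

    rc≡L : r c ≡ L
    rc≡L rewrite ≡⇒≡ᵇ-true {c} refl = refl

•-uniqueLabels : ∀ g₁ g₂ → UniqueLabels (g₁ • g₂) → UniqueLabels g₁ × UniqueLabels g₂
•-uniqueLabels [] g₂ u = []-uniqueLabels , u
•-uniqueLabels (x ∷ xs) [] u = u , []-uniqueLabels
•-uniqueLabels (x ∷ xs) ((a , b) ∷ ys) u = ⊥-elim (•-not-uniqueLabels x xs a b ys u)

tensorAll-uniqueLabels : ∀ ρs → UniqueLabels (foldr _•_ [] ρs) → UniqueLabels (foldr _⊗_ [] ρs)
tensorAll-uniqueLabels [] _ = []-uniqueLabels
tensorAll-uniqueLabels (ρ ∷ ρs) u =
  let uρ , uρs = •-uniqueLabels ρ (foldr _•_ [] ρs) u in ⊗-uniqueLabels uρ (tensorAll-uniqueLabels ρs uρs)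

-- Relabelling invariance of ⊗ and of the ⊗-factorisation

zip-⊗ : ∀ {π π′} ρ ρ′ → order π ≡ order π′ →
  zip (π ⊗ ρ) (π′ ⊗ ρ′) ≡
  zip π π′ ++ map (Product.map (shift (offset π)) (shift (offset π′))) (zip ρ ρ′)
zip-⊗ {π} {π′} ρ ρ′ o = trans (zip-++ π π′ o) (cong (zip π π′ ++_) (zip-map _ _ ρ ρ′))

∈-labelPairs-⊗⁻ : ∀ {π π′ ρ ρ′ p} → order π ≡ order π′ →
  p ∈ labelPairs (π ⊗ ρ) (π′ ⊗ ρ′) →
  p ∈ labelPairs π π′ ⊎ ∃[ q ] q ∈ labelPairs ρ ρ′ × p ≡ (proj₁ q + offset π , proj₂ q + offset π′)
∈-labelPairs-⊗⁻ {π} {π′} {ρ} {ρ′} o p∈ with ∈-labelPairs⁻ p∈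
... | q , q∈ , p≡ with ∈-++⁻ (zip π π′) (subst (q ∈_) (zip-⊗ ρ ρ′ o) q∈)
...   | inj₁ q∈ᴸ = inj₁ (∈-labelPairs⁺ q∈ᴸ p≡)
...   | inj₂ q∈ᴿ with ∈-map⁻ (Product.map (shift (offset π)) (shift (offset π′))) q∈ᴿ
...     | q′ , q′∈ , refl with p≡
...       | inj₁ refl = inj₂ (topPair q′ , ∈-labelPairs⁺ q′∈ (inj₁ refl) , refl)
...       | inj₂ refl = inj₂ (bottomPair q′ , ∈-labelPairs⁺ q′∈ (inj₂ refl) , refl)

⊗-cong-≅ : ∀ {π π′ ρ ρ′} → π ≅ π′ → ρ ≅ ρ′ → π ⊗ ρ ≅ π′ ⊗ ρ′
⊗-cong-≅ {π} {π′} {ρ} {ρ′} π≅π′ ρ≅ρ′ = Coherent⇒≅ order≡′ coherent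
  where
    o = order≡ π≅π′
    order≡′ : order (π ⊗ ρ) ≡ order (π′ ⊗ ρ′)
    order≡′ = trans (order-⊗ π ρ) (trans (cong₂ _+_ o (order≡ ρ≅ρ′)) (sym (order-⊗ π′ ρ′)))

    agree-old-new : ∀ {p} q → p ∈ labelPairs π π′ → Agree p (proj₁ q + offset π , proj₂ q + offset π′)
    agree-old-new q p∈ = let p₁∈ , p₂∈ = ∈-labelPairs⇒∈-labels {π} {π′} p∈ in
      Agree-≢ (∈-labels⇒≢shifted π (proj₁ q) p₁∈) (∈-labels⇒≢shifted π′ (proj₂ q) p₂∈)

    agree-new-old : ∀ {p} q → p ∈ labelPairs π π′ → Agree (proj₁ q + offset π , proj₂ q + offset π′) p
    agree-new-old q p∈ = let p₁∈ , p₂∈ = ∈-labelPairs⇒∈-labels {π} {π′} p∈ in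
      Agree-≢ (≢-sym (∈-labels⇒≢shifted π (proj₁ q) p₁∈))
              (≢-sym (∈-labels⇒≢shifted π′ (proj₂ q) p₂∈))

    coherent : Coherent (labelPairs (π ⊗ ρ) (π′ ⊗ ρ′)) (labelPairs (π ⊗ ρ) (π′ ⊗ ρ′))
    coherent p∈ q∈
      with ∈-labelPairs-⊗⁻ {π} {π′} {ρ} {ρ′} o p∈ | ∈-labelPairs-⊗⁻ {π} {π′} {ρ} {ρ′} o q∈
    ... | inj₁ p∈′ | inj₁ q∈′ = ≅⇒Coherent π≅π′ p∈′ q∈′
    ... | inj₁ p∈′ | inj₂ (q′ , _ , refl) = agree-old-new q′ p∈′
    ... | inj₂ (p′ , _ , refl) | inj₁ q∈′ = agree-new-old p′ q∈′
    ... | inj₂ (p′ , p′∈ , refl) | inj₂ (q′ , q′∈ , refl) =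
      trans (≡ᵇ-+ʳ (offset π) (proj₁ p′) (proj₁ q′))
            (trans (≅⇒Coherent ρ≅ρ′ p′∈ q′∈) (sym (≡ᵇ-+ʳ (offset π′) (proj₂ p′) (proj₂ q′))))

take-cong-≅ : ∀ j {d e} → d ≅ e → take j d ≅ take j e
take-cong-≅ j {d} {e} d≅e = Coherent⇒≅ order≡′
  (Coherent-mono (labelPairs-mono (zip-take⊆ j d e)) (labelPairs-mono (zip-take⊆ j d e)) (≅⇒Coherent d≅e))
  where
    order≡′ = trans (length-take j d) (trans (cong (j ⊓_) (order≡ d≅e)) (sym (length-take j e)))

drop-cong-≅ : ∀ j {d e} → d ≅ e → drop j d ≅ drop j e
drop-cong-≅ j {d} {e} d≅e = Coherent⇒≅ order≡′
  (Coherent-mono (labelPairs-mono (zip-drop⊆ j d e)) (labelPairs-mono (zip-drop⊆ j d e)) (≅⇒Coherent d≅e))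
  where
    order≡′ = trans (length-drop j d) (trans (cong (_∸ j) (order≡ d≅e)) (sym (length-drop j e)))

splitsAt-rows : ∀ j d → splitsAt j d ≡ and (map (not ∘ or) (rows (labels (take j d)) (labels (drop j d))))
splitsAt-rows j d = cong and (map-∘ (labels (take j d)))

splitsAt-cong-≅ : ∀ {d e} → d ≅ e → ∀ j → splitsAt j d ≡ splitsAt j e
splitsAt-cong-≅ {d} {e} d≅e j = begin
  splitsAt j d                                  ≡⟨ splitsAt-rows j d ⟩
  and (map (not ∘ or) (rows (labels dᴸ) (labels dᴿ))) ≡⟨ cong (and ∘ map (not ∘ or)) rows≡ ⟩
  and (map (not ∘ or) (rows (labels eᴸ) (labels eᴿ))) ≡⟨ splitsAt-rows j e ⟨
  splitsAt j e                                  ∎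
  where
    open ≡-Reasoning
    dᴸ = take j d
    eᴸ = take j e
    dᴿ = drop j d
    eᴿ = drop j e
    oᴸ = order≡ (take-cong-≅ j d≅e)
    oᴿ = order≡ (drop-cong-≅ j d≅e)
    rows≡ : rows (labels dᴸ) (labels dᴿ) ≡ rows (labels eᴸ) (labels eᴿ)
    rows≡ = Coherent⇒rows≡ (labels dᴸ) (labels eᴸ) (length-labels dᴸ eᴸ oᴸ) (length-labels dᴿ eᴿ oᴿ)
      (Coherent-mono (labelPairs-mono (zip-take⊆ j d e) ∘ subst (_ ∈_) (zip-labels dᴸ eᴸ oᴸ))
                     (labelPairs-mono (zip-drop⊆ j d e) ∘ subst (_ ∈_) (zip-labels dᴿ eᴿ oᴿ))
                     (≅⇒Coherent d≅e))

splitPoints-cong : ∀ d e → order d ≡ order e → splitPoints d ≡ splitPoints e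
splitPoints-cong [] [] _ = refl
splitPoints-cong (_ ∷ _) (_ ∷ _) o = cong (map suc ∘ upTo) (suc-injective o)

properSplitPoints-cong-≅ : ∀ {d e} → d ≅ e → properSplitPoints d ≡ properSplitPoints e
properSplitPoints-cong-≅ {d} {e} d≅e = trans
  (filterᵇ-cong (λ j → cong (not (j ≡ᵇ 0) ∧_) (splitsAt-cong-≅ d≅e j)) (splitPoints d))
  (cong (filterᵇ (λ j → not (j ≡ᵇ 0) ∧ splitsAt j e)) (splitPoints-cong d e (order≡ d≅e)))

factorsGo-cong-≅ : ∀ n {d e} → d ≅ e → Pointwise _≅_ (factorsGo n d) (factorsGo n e)
factorsGo-cong-≅ zero _ = []
factorsGo-cong-≅ (suc n) {[]} {[]} _ = []
factorsGo-cong-≅ (suc n) {x ∷ d} {y ∷ e} d≅e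
  with properSplitPoints (x ∷ d) | properSplitPoints (y ∷ e) | properSplitPoints-cong-≅ d≅e
... | [] | .[] | refl = d≅e ∷ []
... | j ∷ _ | ._ | refl = take-cong-≅ j d≅e ∷ factorsGo-cong-≅ n (drop-cong-≅ j d≅e)

factors-cong-≅ : ∀ {d e} → d ≅ e → Pointwise _≅_ (factors d) (factors e)
factors-cong-≅ {d} {e} d≅e =
  subst (λ n → Pointwise _≅_ (factors d) (factorsGo n e)) (order≡ d≅e) (factorsGo-cong-≅ (length d) d≅e)

-- Well-definedness and closure of the operations of ParSym

foldr-cong-Pointwise : ∀ {a b r} {A : Set a} {B : Set b} {R : A → A → Set r} {f : A → B → B} {z} →
  (∀ {a a′ acc} → R a a′ → f a acc ≡ f a′ acc) →
  ∀ {as as′} → Pointwise R as as′ → foldr f z as ≡ foldr f z as′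
foldr-cong-Pointwise f-resp [] = refl
foldr-cong-Pointwise {f = f} f-resp (_∷_ {x = a} {y = a′} a∼a′ as∼as′) =
  trans (f-resp a∼a′) (cong (f a′) (foldr-cong-Pointwise f-resp as∼as′))

concatMap-All : ∀ {a b p} {A : Set a} {B : Set b} {P : B → Set p} {f : A → List B} →
  (∀ z → All P (f z)) → ∀ xs → All P (concatMap f xs)
concatMap-All all-f xs = concat⁺ (map⁺ (All.universal all-f xs))

module Linear {c ℓ : Level} (F : Field c ℓ) where
  open ParSym F
  open Field F
    using (Carrier; 0#; 1#; _≈_; setoid; reflexive; +-cong; *-cong; +-assoc; distribˡ; distribʳ;
           zeroˡ; zeroʳ; +-identityˡ; +-identityʳ; *-identityʳ; +-commutativeSemigroup)
    renaming (_+_ to _+ᴷ_; _*_ to _*ᴷ_; refl to ≈-refl; sym to ≈-sym; trans to ≈-trans)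
  open import Algebra.Properties.CommutativeSemigroup +-commutativeSemigroup using (x∙yz≈y∙xz)
  open import Relation.Binary.Reasoning.Setoid setoid

  infix 4 _≈ᶜ_
  _≈ᶜ_ : Elem → Elem → Set ℓ
  x ≈ᶜ y = ∀ d → coeff x d ≈ coeff y d

  linearExtension : (Diagram → Carrier) → Elem → Carrier
  linearExtension g [] = 0#
  linearExtension g ((a , π) ∷ x) = a *ᴷ g π +ᴷ linearExtension g x

  linearExtension-cong : ∀ {g g′} → (∀ π → g π ≈ g′ π) →
                         ∀ x → linearExtension g x ≈ linearExtension g′ x
  linearExtension-cong g≈g′ [] = ≈-refl
  linearExtension-cong g≈g′ ((a , π) ∷ x) = +-cong (*-cong ≈-refl (g≈g′ π)) (linearExtension-cong g≈g′ x)

  removeClass : Diagram → Elem → Elem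
  removeClass i [] = []
  removeClass i ((b , j) ∷ x) = if sameᵇ j i then removeClass i x else (b , j) ∷ removeClass i x

  coeff-removeClass-same : ∀ {i d} → i ≅ d → ∀ x → coeff (removeClass i x) d ≡ 0#
  coeff-removeClass-same i≅d [] = refl
  coeff-removeClass-same {i} {d} i≅d ((b , j) ∷ x) with sameᵇ j i in j~i
  ... | true = coeff-removeClass-same i≅d x
  ... | false rewrite trans (sameᵇ-respʳ j (≅-sym i≅d)) j~i = coeff-removeClass-same i≅d x

  coeff-removeClass-other : ∀ {i d} → sameᵇ i d ≡ false → ∀ x → coeff (removeClass i x) d ≡ coeff x d
  coeff-removeClass-other i≁d [] = refl
  coeff-removeClass-other {i} {d} i≁d ((b , j) ∷ x) with sameᵇ j i in j~i
  ... | true with sameᵇ j d in j~d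
  ...   | true with () ← trans (sym j~d) (trans (sameᵇ-respˡ d (sameᵇ⇒≅ j i j~i)) i≁d)
  ...   | false = coeff-removeClass-other i≁d x
  coeff-removeClass-other {i} {d} i≁d ((b , j) ∷ x) | false with sameᵇ j d
  ...   | true = cong (b +ᴷ_) (coeff-removeClass-other i≁d x)
  ...   | false = coeff-removeClass-other i≁d x

  removeClass-resp-≈ᶜ : ∀ i x y → x ≈ᶜ y → removeClass i x ≈ᶜ removeClass i y
  removeClass-resp-≈ᶜ i x y x≈y d with sameᵇ i d in i~d
  ... | true = reflexive (trans (coeff-removeClass-same i≅d x) (sym (coeff-removeClass-same i≅d y)))
    where i≅d = sameᵇ⇒≅ i d i~d
  ... | false = ≈-trans (reflexive (coeff-removeClass-other i~d x))
                       (≈-trans (x≈y d) (reflexive (sym (coeff-removeClass-other i~d y))))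

  length-removeClass : ∀ i x → length (removeClass i x) ≤ length x
  length-removeClass i [] = z≤n
  length-removeClass i ((b , j) ∷ x) with sameᵇ j i
  ... | true = ≤-trans (length-removeClass i x) (n≤1+n _)
  ... | false = s≤s (length-removeClass i x)

  length-removeClass-head : ∀ i a x → length (removeClass i ((a , i) ∷ x)) ≤ length x
  length-removeClass-head i a x rewrite sameᵇ-refl i = length-removeClass i x

  module _ (g : Diagram → Carrier) (g-resp : ∀ {π π′} → π ≅ π′ → g π ≈ g π′) where

    linearExtension-removeClass : ∀ i x →
      linearExtension g x ≈ coeff x i *ᴷ g i +ᴷ linearExtension g (removeClass i x)
    linearExtension-removeClass i [] = ≈-sym (≈-trans (+-identityʳ _) (zeroˡ (g i)))
    linearExtension-removeClass i ((b , j) ∷ x) with sameᵇ j i in j~i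
    ... | true = begin
      b *ᴷ g j +ᴷ linearExtension g x
        ≈⟨ +-cong (*-cong ≈-refl (g-resp (sameᵇ⇒≅ j i j~i))) (linearExtension-removeClass i x) ⟩
      b *ᴷ g i +ᴷ (coeff x i *ᴷ g i +ᴷ linearExtension g (removeClass i x))
        ≈⟨ +-assoc _ _ _ ⟨
      (b *ᴷ g i +ᴷ coeff x i *ᴷ g i) +ᴷ linearExtension g (removeClass i x)
        ≈⟨ +-cong (distribʳ (g i) b (coeff x i)) ≈-refl ⟨
      (b +ᴷ coeff x i) *ᴷ g i +ᴷ linearExtension g (removeClass i x) ∎
    ... | false = begin
      b *ᴷ g j +ᴷ linearExtension g x
        ≈⟨ +-cong ≈-refl (linearExtension-removeClass i x) ⟩
      b *ᴷ g j +ᴷ (coeff x i *ᴷ g i +ᴷ linearExtension g (removeClass i x))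
        ≈⟨ x∙yz≈y∙xz _ _ _ ⟩
      coeff x i *ᴷ g i +ᴷ (b *ᴷ g j +ᴷ linearExtension g (removeClass i x)) ∎

    linearExtension-via-removeClass : ∀ i x y → x ≈ᶜ y →
      linearExtension g (removeClass i x) ≈ linearExtension g (removeClass i y) →
      linearExtension g x ≈ linearExtension g y
    linearExtension-via-removeClass i x y x≈y rest≈ = begin
      linearExtension g x                                          ≈⟨ linearExtension-removeClass i x ⟩
      coeff x i *ᴷ g i +ᴷ linearExtension g (removeClass i x)      ≈⟨ +-cong (*-cong (x≈y i) ≈-refl) rest≈ ⟩
      coeff y i *ᴷ g i +ᴷ linearExtension g (removeClass i y)      ≈⟨ linearExtension-removeClass i y ⟨
      linearExtension g y                                          ∎

    linearExtension-resp-≈ᶜ : ∀ x y → x ≈ᶜ y → linearExtension g x ≈ linearExtension g y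
    linearExtension-resp-≈ᶜ x y = bounded (length x + length y) x y ≤-refl
      where
        bounded : ∀ n x y → length x + length y ≤ n → x ≈ᶜ y → linearExtension g x ≈ linearExtension g y
        bounded _ [] [] _ _ = ≈-refl
        bounded (suc n) x@((a , i) ∷ x′) y (s≤s le) x≈y = linearExtension-via-removeClass i x y x≈y
          (bounded n (removeClass i x) (removeClass i y)
            (≤-trans (+-mono-≤ (length-removeClass-head i a x′) (length-removeClass i y)) le)
            (removeClass-resp-≈ᶜ i x y x≈y))
        bounded (suc n) [] y@((b , i) ∷ y′) (s≤s le) x≈y = linearExtension-via-removeClass i [] y x≈y
          (bounded n [] (removeClass i y) (≤-trans (length-removeClass-head i b y′) le)
            (removeClass-resp-≈ᶜ i [] y x≈y))

  coeff-++ : ∀ x y d → coeff (x ++ y) d ≈ coeff x d +ᴷ coeff y d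
  coeff-++ [] y d = ≈-sym (+-identityˡ _)
  coeff-++ ((a , π) ∷ x) y d with sameᵇ π d
  ... | true = ≈-trans (+-cong ≈-refl (coeff-++ x y d)) (≈-sym (+-assoc _ _ _))
  ... | false = coeff-++ x y d

  coeff₂-++ : ∀ x y d e → coeff₂ (x ++ y) d e ≈ coeff₂ x d e +ᴷ coeff₂ y d e
  coeff₂-++ [] y d e = ≈-sym (+-identityˡ _)
  coeff₂-++ ((a , π , ρ) ∷ x) y d e with sameᵇ π d ∧ sameᵇ ρ e
  ... | true = ≈-trans (+-cong ≈-refl (coeff₂-++ x y d e)) (≈-sym (+-assoc _ _ _))
  ... | false = coeff₂-++ x y d e

  coeff-scale : ∀ a x d → coeff (scale a x) d ≈ a *ᴷ coeff x d
  coeff-scale a [] d = ≈-sym (zeroʳ a)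
  coeff-scale a ((b , π) ∷ x) d with sameᵇ π d
  ... | true = ≈-trans (+-cong ≈-refl (coeff-scale a x d)) (≈-sym (distribˡ a b _))
  ... | false = coeff-scale a x d

  coeff₂-scale₂ : ∀ a x d e → coeff₂ (scale₂ a x) d e ≈ a *ᴷ coeff₂ x d e
  coeff₂-scale₂ a [] d e = ≈-sym (zeroʳ a)
  coeff₂-scale₂ a ((b , π , ρ) ∷ x) d e with sameᵇ π d ∧ sameᵇ ρ e
  ... | true = ≈-trans (+-cong ≈-refl (coeff₂-scale₂ a x d e)) (≈-sym (distribˡ a b _))
  ... | false = coeff₂-scale₂ a x d e

  coeff-S : ∀ x d → coeff (S x) d ≈ linearExtension (λ π → coeff (SH π) d) x
  coeff-S [] d = ≈-refl
  coeff-S ((a , π) ∷ x) d =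
    ≈-trans (coeff-++ (scale a (SH π)) (S x) d) (+-cong (coeff-scale a (SH π) d) (coeff-S x d))

  coeff₂-Δ : ∀ x d e → coeff₂ (Δ x) d e ≈ linearExtension (λ π → coeff₂ (ΔH π) d e) x
  coeff₂-Δ [] d e = ≈-refl
  coeff₂-Δ ((a , π) ∷ x) d e =
    ≈-trans (coeff₂-++ (scale₂ a (ΔH π)) (Δ x) d e) (+-cong (coeff₂-scale₂ a (ΔH π) d e) (coeff₂-Δ x d e))

  productCoeff : Diagram → Diagram → Diagram → Carrier
  productCoeff d π ρ = if sameᵇ (π ⊗ ρ) d then 1# else 0#

  productCoeff-cong : ∀ d {π π′ ρ ρ′} → π ≅ π′ → ρ ≅ ρ′ → productCoeff d π ρ ≈ productCoeff d π′ ρ′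
  productCoeff-cong d π≅π′ ρ≅ρ′ =
    reflexive (cong (λ b → if b then 1# else 0#) (sameᵇ-respˡ d (⊗-cong-≅ π≅π′ ρ≅ρ′)))

  leftMul : Carrier → Diagram → Carrier × Diagram → Carrier × Diagram
  leftMul a π (b , ρ) = a *ᴷ b , π ⊗ ρ

  coeff-map-leftMul : ∀ a π y d → coeff (map (leftMul a π) y) d ≈ a *ᴷ linearExtension (productCoeff d π) y
  coeff-map-leftMul a π [] d = ≈-sym (zeroʳ a)
  coeff-map-leftMul a π ((b , ρ) ∷ y) d with sameᵇ (π ⊗ ρ) d
  ... | true = begin
    a *ᴷ b +ᴷ coeff (map (leftMul a π) y) d
      ≈⟨ +-cong (*-cong ≈-refl (≈-sym (*-identityʳ b))) (coeff-map-leftMul a π y d) ⟩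
    a *ᴷ (b *ᴷ 1#) +ᴷ a *ᴷ linearExtension (productCoeff d π) y
      ≈⟨ distribˡ a _ _ ⟨
    a *ᴷ (b *ᴷ 1# +ᴷ linearExtension (productCoeff d π) y) ∎
  ... | false = begin
    coeff (map (leftMul a π) y) d
      ≈⟨ coeff-map-leftMul a π y d ⟩
    a *ᴷ linearExtension (productCoeff d π) y
      ≈⟨ *-cong ≈-refl (≈-trans (+-cong (zeroʳ b) ≈-refl) (+-identityˡ _)) ⟨
    a *ᴷ (b *ᴷ 0# +ᴷ linearExtension (productCoeff d π) y) ∎

  coeff-· : ∀ x y d → coeff (x · y) d ≈ linearExtension (λ π → linearExtension (productCoeff d π) y) x
  coeff-· [] y d = ≈-refl
  coeff-· ((a , π) ∷ x) y d =
    ≈-trans (coeff-++ (map (leftMul a π) y) (x · y) d) (+-cong (coeff-map-leftMul a π y d) (coeff-· x y d))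

  SIrr-term : Diagram → List Diagram → Elem
  SIrr-term π ρs = if sameᵇ (bulletAll ρs) π then (sign (length ρs) , tensorAll ρs) ∷ [] else []

  ΔIrr-term : Diagram → Diagram × Diagram → Elem₂
  ΔIrr-term π (g₁ , g₂) =
    if emptyOrIrreducibleᵇ g₁ ∧ emptyOrIrreducibleᵇ g₂ ∧ sameᵇ (g₁ • g₂) π then (1# , g₁ , g₂) ∷ [] else []

  SIrr-cong-≅ : ∀ {π π′} → π ≅ π′ → SIrr π ≡ SIrr π′
  SIrr-cong-≅ {π} {π′} π≅π′ = trans
    (concatMap-cong {f = SIrr-term π} {g = SIrr-term π′}
       (λ ρs → cong (λ b → if b then (sign (length ρs) , tensorAll ρs) ∷ [] else [])
                    (sameᵇ-respʳ (bulletAll ρs) π≅π′))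
       (concatMap tuplesOfOrders (compositions (order π))))
    (cong (λ n → concatMap (SIrr-term π′) (concatMap tuplesOfOrders (compositions n))) (order≡ π≅π′))

  ΔIrr-cong-≅ : ∀ {π π′} → π ≅ π′ → ΔIrr π ≡ ΔIrr π′
  ΔIrr-cong-≅ {π} {π′} π≅π′ = trans
    (concatMap-cong {f = ΔIrr-term π} {g = ΔIrr-term π′}
       (λ { (g₁ , g₂) → cong (λ b → if emptyOrIrreducibleᵇ g₁ ∧ emptyOrIrreducibleᵇ g₂ ∧ b
                                    then (1# , g₁ , g₂) ∷ [] else [])
                             (sameᵇ-respʳ (g₁ • g₂) π≅π′) })
       (pairsOfTotalOrder (order π)))
    (cong (λ n → concatMap (ΔIrr-term π′) (pairsOfTotalOrder n)) (order≡ π≅π′))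

  SH-cong-≅ : ∀ {π π′} → π ≅ π′ → SH π ≡ SH π′
  SH-cong-≅ π≅π′ =
    foldr-cong-Pointwise (λ {_} {_} {acc} σ≅σ′ → cong (acc ·_) (SIrr-cong-≅ σ≅σ′)) (factors-cong-≅ π≅π′)

  ΔH-cong-≅ : ∀ {π π′} → π ≅ π′ → ΔH π ≡ ΔH π′
  ΔH-cong-≅ π≅π′ =
    foldr-cong-Pointwise (λ {_} {_} {acc} σ≅σ′ → cong (_·₂ acc) (ΔIrr-cong-≅ σ≅σ′)) (factors-cong-≅ π≅π′)

  S-resp-≈ᶜ : ∀ x y → x ≈ᶜ y → S x ≈ᶜ S y
  S-resp-≈ᶜ x y x≈y d = begin
    coeff (S x) d                                ≈⟨ coeff-S x d ⟩
    linearExtension (λ π → coeff (SH π) d) x     ≈⟨ linearExtension-resp-≈ᶜ _ SH-resp x y x≈y ⟩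
    linearExtension (λ π → coeff (SH π) d) y     ≈⟨ coeff-S y d ⟨
    coeff (S y) d                                ∎
    where
      SH-resp : ∀ {π π′} → π ≅ π′ → coeff (SH π) d ≈ coeff (SH π′) d
      SH-resp π≅π′ = reflexive (cong (λ z → coeff z d) (SH-cong-≅ π≅π′))

  Δ-resp-≈ᶜ : ∀ x y → x ≈ᶜ y → ∀ d e → coeff₂ (Δ x) d e ≈ coeff₂ (Δ y) d e
  Δ-resp-≈ᶜ x y x≈y d e = begin
    coeff₂ (Δ x) d e                              ≈⟨ coeff₂-Δ x d e ⟩
    linearExtension (λ π → coeff₂ (ΔH π) d e) x   ≈⟨ linearExtension-resp-≈ᶜ _ ΔH-resp x y x≈y ⟩
    linearExtension (λ π → coeff₂ (ΔH π) d e) y   ≈⟨ coeff₂-Δ y d e ⟨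
    coeff₂ (Δ y) d e                              ∎
    where
      ΔH-resp : ∀ {π π′} → π ≅ π′ → coeff₂ (ΔH π) d e ≈ coeff₂ (ΔH π′) d e
      ΔH-resp π≅π′ = reflexive (cong (λ z → coeff₂ z d e) (ΔH-cong-≅ π≅π′))

  ·-resp-≈ᶜ : ∀ x x′ y y′ → x ≈ᶜ x′ → y ≈ᶜ y′ → x · y ≈ᶜ x′ · y′
  ·-resp-≈ᶜ x x′ y y′ x≈x′ y≈y′ d = begin
    coeff (x · y) d
      ≈⟨ coeff-· x y d ⟩
    linearExtension (λ π → linearExtension (productCoeff d π) y) x
      ≈⟨ linearExtension-cong (λ π → linearExtension-resp-≈ᶜ _ (productCoeff-cong d (≅-refl {π})) y y′ y≈y′) x ⟩
    linearExtension (λ π → linearExtension (productCoeff d π) y′) x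
      ≈⟨ linearExtension-resp-≈ᶜ _ left-resp x x′ x≈x′ ⟩
    linearExtension (λ π → linearExtension (productCoeff d π) y′) x′
      ≈⟨ coeff-· x′ y′ d ⟨
    coeff (x′ · y′) d ∎
    where
      left-resp : ∀ {π π′} → π ≅ π′ → linearExtension (productCoeff d π) y′ ≈ linearExtension (productCoeff d π′) y′
      left-resp π≅π′ = linearExtension-cong (λ ρ → productCoeff-cong d π≅π′ (≅-refl {ρ})) y′

  AllUnique : Elem → Set c
  AllUnique = All (UniqueLabels ∘ proj₂)

  AllUnique₂ : Elem₂ → Set c
  AllUnique₂ = All (λ t → UniqueLabels (proj₁ (proj₂ t)) × UniqueLabels (proj₂ (proj₂ t)))

  ·-AllUnique : ∀ {x y} → AllUnique x → AllUnique y → AllUnique (x · y)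
  ·-AllUnique ux uy = concat⁺ (map⁺ (All.map (λ uπ → map⁺ (All.map (⊗-uniqueLabels uπ) uy)) ux))

  ·₂-AllUnique₂ : ∀ {x y} → AllUnique₂ x → AllUnique₂ y → AllUnique₂ (x ·₂ y)
  ·₂-AllUnique₂ ux uy = concat⁺ (map⁺ (All.map
    (λ { (uπ₁ , uπ₂) → map⁺ (All.map (Product.zip ⊗-uniqueLabels ⊗-uniqueLabels (uπ₁ , uπ₂)) uy) }) ux))

  SIrr-AllUnique : ∀ {σ} → UniqueLabels σ → AllUnique (SIrr σ)
  SIrr-AllUnique {σ} uσ = concatMap-All term (concatMap tuplesOfOrders (compositions (order σ)))
    where
      term : ∀ ρs → AllUnique (SIrr-term σ ρs)
      term ρs with sameᵇ (bulletAll ρs) σ in same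
      ... | true = tensorAll-uniqueLabels ρs (uniqueLabels-resp-≅ (≅-sym (sameᵇ⇒≅ _ σ same)) uσ) ∷ []
      ... | false = []

  ΔIrr-AllUnique₂ : ∀ {σ} → UniqueLabels σ → AllUnique₂ (ΔIrr σ)
  ΔIrr-AllUnique₂ {σ} uσ = concatMap-All term (pairsOfTotalOrder (order σ))
    where
      term : ∀ g → AllUnique₂ (ΔIrr-term σ g)
      term (g₁ , g₂) with emptyOrIrreducibleᵇ g₁ ∧ emptyOrIrreducibleᵇ g₂ ∧ sameᵇ (g₁ • g₂) σ in cond
      ... | true =
        let same = proj₂ (∧-true⇒ {emptyOrIrreducibleᵇ g₂} (proj₂ (∧-true⇒ {emptyOrIrreducibleᵇ g₁} cond)))
        in •-uniqueLabels g₁ g₂ (uniqueLabels-resp-≅ (≅-sym (sameᵇ⇒≅ (g₁ • g₂) σ same)) uσ) ∷ []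
      ... | false = []

  SH-AllUnique : ∀ {π} → UniqueLabels π → AllUnique (SH π)
  SH-AllUnique uπ = fold (factors-uniqueLabels uπ)
    where
      fold : ∀ {σs} → All UniqueLabels σs → AllUnique (foldr (λ σ acc → acc · SIrr σ) unitH σs)
      fold [] = []-uniqueLabels ∷ []
      fold (uσ ∷ uσs) = ·-AllUnique (fold uσs) (SIrr-AllUnique uσ)

  ΔH-AllUnique₂ : ∀ {π} → UniqueLabels π → AllUnique₂ (ΔH π)
  ΔH-AllUnique₂ uπ = fold (factors-uniqueLabels uπ)
    where
      fold : ∀ {σs} → All UniqueLabels σs →
             AllUnique₂ (foldr (λ σ acc → ΔIrr σ ·₂ acc) ((1# , [] , []) ∷ []) σs)
      fold [] = ([]-uniqueLabels , []-uniqueLabels) ∷ []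
      fold (uσ ∷ uσs) = ·₂-AllUnique₂ (ΔIrr-AllUnique₂ uσ) (fold uσs)

  S-AllUnique : ∀ {x} → AllUnique x → AllUnique (S x)
  S-AllUnique ux = concat⁺ (map⁺ (All.map (λ uπ → map⁺ (SH-AllUnique uπ)) ux))

  Δ-AllUnique₂ : ∀ {x} → AllUnique x → AllUnique₂ (Δ x)
  Δ-AllUnique₂ ux = concat⁺ (map⁺ (All.map (λ uπ → map⁺ (ΔH-AllUnique₂ uπ)) ux))

  private
    toUnique : ∀ {l} → All (IsPartialPerm ∘ proj₂) l → AllUnique l
    toUnique = All.map (partialPerm⇒uniqueLabels _)

    fromUnique : ∀ {l} → AllUnique l → All (IsPartialPerm ∘ proj₂) l
    fromUnique = All.map (uniqueLabels⇒partialPerm _)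

    fromUnique₂ : ∀ {l} → AllUnique₂ l →
      All (λ t → IsPartialPerm (proj₁ (proj₂ t)) × IsPartialPerm (proj₂ (proj₂ t))) l
    fromUnique₂ = All.map (Product.map (uniqueLabels⇒partialPerm _) (uniqueLabels⇒partialPerm _))

  unitH-InSpanPP : InSpanPP unitH
  unitH-InSpanPP = unitH , uniqueLabels⇒partialPerm [] []-uniqueLabels ∷ [] , λ _ → ≈-refl

  ·-InSpanPP : ∀ x y → InSpanPP x → InSpanPP y → InSpanPP (x · y)
  ·-InSpanPP x y (lx , ppx , lx≈x) (ly , ppy , ly≈y) =
    lx · ly , fromUnique (·-AllUnique (toUnique ppx) (toUnique ppy)) , ·-resp-≈ᶜ lx x ly y lx≈x ly≈y

  Δ-InSpanPP₂ : ∀ x → InSpanPP x → InSpanPP₂ (Δ x)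
  Δ-InSpanPP₂ x (l , pp , l≈x) = Δ l , fromUnique₂ (Δ-AllUnique₂ (toUnique pp)) , Δ-resp-≈ᶜ l x l≈x

  S-InSpanPP : ∀ x → InSpanPP x → InSpanPP (S x)
  S-InSpanPP x (l , pp , l≈x) = S l , fromUnique (S-AllUnique (toUnique pp)) , S-resp-≈ᶜ l x l≈x

theorem4p4 : ∀ {c ℓ} (F : Field c ℓ) → let open ParSym F in
    InSpanPP unitH ×
    (∀ x y → InSpanPP x → InSpanPP y → InSpanPP (x · y)) ×
    (∀ x → InSpanPP x → InSpanPP₂ (Δ x)) ×
    (∀ x → InSpanPP x → InSpanPP (S x))
theorem4p4 F = unitH-InSpanPP , ·-InSpanPP , Δ-InSpanPP₂ , S-InSpanPP
  where open Linear F
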